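{- Let $T$ be a tournament on strategies $\{1,\dots,n\}$, viewed as a Rock Paper Scissors variant, with Nash equilibrium $\vec a$. If strategy $s$ dominates strategy $t$, then $a_t=0$.
   Context: A Rock Paper Scissors variant is given by a tournament on strategies $\{1,\dots,n\}$: for distinct $i,j$ exactly one of "$i$ beats $j$" or "$j$ beats $i$" holds. Define $g_{ij}=2$ if $i$ beats $j$, $g_{ii}=1$, and $g_{ij}=0$ if $j$ beats $i$. A strategy profile is a vector $\vec a$ with $a_i\ge 0$ and $\sum_i a_i=1$. A Nash equilibrium is a strategy profile $\vec a$ such that for every strategy profile $\vec b$, $\sum_{i,j} g_{ij}a_ib_j\ge 1$; it is unique for such games. Strategy $s$ dominates strategy $t$ if $s$ beats $t$ and there is no other strategy $k$ such that $t$ beats $k$ and $k$ beats $s$.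
   Formalization: Strategy profiles have rational entries, both the Nash equilibrium $\vec a$ and the profiles $\vec b$ against which the equilibrium condition is tested. -}

module Defs where

open import Data.Nat using (ℕ; zero; suc)
open import Data.Fin using (Fin; zero; suc; _≟_)
open import Data.Bool using (Bool; true; false; not; if_then_else_)
open import Data.Integer using (+_)
open import Data.Rational using (ℚ; 0ℚ; 1ℚ; _+_; _*_; _≤_; _/_)
open import Data.Product using (Σ; _×_; ∃)
open import Relation.Nullary using (¬_; Dec; yes; no)
open import Relation.Binary.PropositionalEquality using (_≡_; _≢_)

record Tournament (n : ℕ) : Set where
  field
    beats      : Fin n → Fin n → Bool
    irrefl     : ∀ i → beats i i ≡ false
    exactlyOne : ∀ i j → i ≢ j → beats j i ≡ not (beats i j)

open Tournament public

∑ : {n : ℕ} → (Fin n → ℚ) → ℚ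
∑ {zero}  f = 0ℚ
∑ {suc n} f = f zero + ∑ (λ i → f (suc i))

g : {n : ℕ} → Tournament n → Fin n → Fin n → ℚ
g T i j with i ≟ j
... | yes _ = 1ℚ
... | no  _ = if beats T i j then + 2 / 1 else 0ℚ

IsProfile : {n : ℕ} → (Fin n → ℚ) → Set
IsProfile {n} a = (∀ i → 0ℚ ≤ a i) × ∑ a ≡ 1ℚ

IsNashEquilibrium : {n : ℕ} → Tournament n → (Fin n → ℚ) → Set
IsNashEquilibrium {n} T a =
  IsProfile a ×
  (∀ (b : Fin n → ℚ) → IsProfile b →
     1ℚ ≤ ∑ (λ i → ∑ (λ j → g T i j * a i * b j)))

Dominates : {n : ℕ} → Tournament n → Fin n → Fin n → Set
Dominates {n} T s t =
  beats T s t ≡ true ×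
  ¬ (Σ (Fin n) λ k → k ≢ s × k ≢ t × beats T t k ≡ true × beats T k s ≡ true)

{-# OPTIONS --safe #-}
module Submission where

-- Write P(x, y) for the payoff of x against y and R_i(y) for the payoff of the pure strategy i
-- against y. Since g i j + g j i = 2, P(x, y) + P(y, x) = 2 for profiles x, y; so against the
-- Nash equilibrium a no profile earns more than 1, while 1 ≤ P(a, a). Let a' be a with the
-- weight of t moved onto s. Then P(a', a) = P(a, a) + a_t (R_s(a) - R_t(a)), and domination
-- gives g s j - g t j ≥ [j = t] for every j, hence R_s(a) - R_t(a) ≥ a_t. Together,
-- a_t² ≤ a_t (R_s(a) - R_t(a)) = P(a', a) - P(a, a) ≤ 0.

open import Defs
open import Data.Nat using (ℕ; zero; suc)
open import Data.Fin using (Fin; zero; suc; _≟_)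
open import Data.Bool using (true; false; if_then_else_)
import Data.Integer as ℤ
open import Data.Rational
  using (ℚ; 0ℚ; 1ℚ; _+_; _*_; -_; _-_; _/_; _≤_; _<_; positive; nonNegative)
open import Data.Rational.Properties
  using ( +-*-commutativeRing; ≤-refl; ≤-reflexive; ≤-antisym; ≮⇒≥; ≤ᵇ⇒≤; <-irrefl; <-≤-trans
        ; +-identityˡ; +-identityʳ; *-identityˡ; *-identityʳ; *-zeroˡ; *-zeroʳ
        ; +-mono-≤; +-monoˡ-≤; *-monoˡ-≤-nonNeg; *-monoʳ-≤-nonNeg; positive⁻¹; pos*pos⇒pos
        ; module ≤-Reasoning )
open import Data.Rational.Solver using (module +-*-Solver)
open import Algebra.Bundles using (CommutativeRing)
import Algebra.Properties.Semiring.Sum (CommutativeRing.semiring +-*-commutativeRing) as Sum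
open import Data.Product using (_,_)
open import Data.Empty using (⊥-elim)
open import Relation.Nullary using (¬_; yes; no; does)
open import Relation.Binary.PropositionalEquality
  using (_≡_; _≢_; refl; sym; trans; cong; cong₂; module ≡-Reasoning)
open import Function using (_∘_)
open +-*-Solver using (solve; con; _:+_; _:*_; _:-_; _:=_)

private
  variable
    n : ℕ

∑≡sum : (f : Fin n → ℚ) → ∑ f ≡ Sum.sum f
∑≡sum {zero}  f = refl
∑≡sum {suc n} f = cong (f zero +_) (∑≡sum (λ i → f (suc i)))

∑-cong : {f h : Fin n → ℚ} → (∀ i → f i ≡ h i) → ∑ f ≡ ∑ h
∑-cong {f = f} {h} f≗h = trans (∑≡sum f) (trans (Sum.sum-cong-≗ f≗h) (sym (∑≡sum h)))

∑-distrib-+ : (f h : Fin n → ℚ) → ∑ (λ i → f i + h i) ≡ ∑ f + ∑ h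
∑-distrib-+ f h = begin
  ∑ (λ i → f i + h i)          ≡⟨ ∑≡sum (λ i → f i + h i) ⟩
  Sum.sum (λ i → f i + h i)    ≡⟨ Sum.∑-distrib-+ f h ⟩
  Sum.sum f + Sum.sum h        ≡⟨ sym (cong₂ _+_ (∑≡sum f) (∑≡sum h)) ⟩
  ∑ f + ∑ h                    ∎
  where open ≡-Reasoning

*-distribˡ-∑ : (c : ℚ) (f : Fin n → ℚ) → c * ∑ f ≡ ∑ (λ i → c * f i)
*-distribˡ-∑ c f = begin
  c * ∑ f                    ≡⟨ cong (c *_) (∑≡sum f) ⟩
  c * Sum.sum f              ≡⟨ Sum.*-distribˡ-sum c f ⟩
  Sum.sum (λ i → c * f i)    ≡⟨ sym (∑≡sum (λ i → c * f i)) ⟩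
  ∑ (λ i → c * f i)          ∎
  where open ≡-Reasoning

*-distribʳ-∑ : (c : ℚ) (f : Fin n → ℚ) → ∑ f * c ≡ ∑ (λ i → f i * c)
*-distribʳ-∑ c f = begin
  ∑ f * c                    ≡⟨ cong (_* c) (∑≡sum f) ⟩
  Sum.sum f * c              ≡⟨ Sum.*-distribʳ-sum c f ⟩
  Sum.sum (λ i → f i * c)    ≡⟨ sym (∑≡sum (λ i → f i * c)) ⟩
  ∑ (λ i → f i * c)          ∎
  where open ≡-Reasoning

∑-comm : {n m : ℕ} (f : Fin n → Fin m → ℚ) →
         ∑ (λ i → ∑ (f i)) ≡ ∑ (λ j → ∑ (λ i → f i j))
∑-comm {n} {m} f = begin
  ∑ (λ i → ∑ (f i))                      ≡⟨ ∑≡sum∑≡sum f ⟩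
  Sum.sum (λ i → Sum.sum (f i))          ≡⟨ Sum.∑-comm f ⟩
  Sum.sum (λ j → Sum.sum (λ i → f i j))  ≡⟨ sym (∑≡sum∑≡sum {m} {n} (λ j i → f i j)) ⟩
  ∑ (λ j → ∑ (λ i → f i j))              ∎
  where
  open ≡-Reasoning
  ∑≡sum∑≡sum : {k l : ℕ} (h : Fin k → Fin l → ℚ) →
               ∑ (λ i → ∑ (h i)) ≡ Sum.sum (λ i → Sum.sum (h i))
  ∑≡sum∑≡sum h = trans (∑≡sum (λ i → ∑ (h i))) (Sum.sum-cong-≗ (λ i → ∑≡sum (h i)))

∑-distrib-- : (f h : Fin n → ℚ) → ∑ (λ i → f i - h i) ≡ ∑ f - ∑ h
∑-distrib-- {zero}  f h = refl
∑-distrib-- {suc n} f h = begin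
  (f zero - h zero) + ∑ (λ i → f (suc i) - h (suc i))
    ≡⟨ cong (f zero - h zero +_) (∑-distrib-- (λ i → f (suc i)) (λ i → h (suc i))) ⟩
  (f zero - h zero) + (F - H)
    ≡⟨ solve 4 (λ a b c d → (a :- b) :+ (c :- d) := (a :+ c) :- (b :+ d)) refl (f zero) (h zero) F H ⟩
  (f zero + F) - (h zero + H)
    ∎
  where
  open ≡-Reasoning
  F = ∑ (λ i → f (suc i))
  H = ∑ (λ i → h (suc i))

∑*∑ : {m : ℕ} (x : Fin n → ℚ) (y : Fin m → ℚ) →
      ∑ x * ∑ y ≡ ∑ (λ i → ∑ (λ j → x i * y j))
∑*∑ x y = trans (*-distribʳ-∑ (∑ y) x) (∑-cong (λ i → *-distribˡ-∑ (x i) y))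

∑-mono-≤ : {f h : Fin n → ℚ} → (∀ i → f i ≤ h i) → ∑ f ≤ ∑ h
∑-mono-≤ {zero}  f≤h = ≤-refl
∑-mono-≤ {suc n} f≤h = +-mono-≤ (f≤h zero) (∑-mono-≤ (λ i → f≤h (suc i)))

δ : Fin n → Fin n → ℚ
δ k i = if does (k ≟ i) then 1ℚ else 0ℚ

δ-diag : (k : Fin n) → δ k k ≡ 1ℚ
δ-diag k with k ≟ k
... | yes _   = refl
... | no  k≢k = ⊥-elim (k≢k refl)

δ-offDiag : {k i : Fin n} → k ≢ i → δ k i ≡ 0ℚ
δ-offDiag {k = k} {i} k≢i with k ≟ i
... | yes k≡i = ⊥-elim (k≢i k≡i)
... | no  _   = refl

∑-δ : (k : Fin n) (f : Fin n → ℚ) → ∑ (λ i → δ k i * f i) ≡ f k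
∑-δ {suc n} zero    f = begin
  1ℚ * f zero + ∑ (λ i → 0ℚ * f (suc i))  ≡⟨ cong₂ _+_ (*-identityˡ (f zero)) (sym (*-distribˡ-∑ 0ℚ F)) ⟩
  f zero + 0ℚ * ∑ F                       ≡⟨ cong (f zero +_) (*-zeroˡ (∑ F)) ⟩
  f zero + 0ℚ                             ≡⟨ +-identityʳ (f zero) ⟩
  f zero                                  ∎
  where
  open ≡-Reasoning
  F = λ i → f (suc i)
∑-δ {suc n} (suc k) f = begin
  0ℚ * f zero + ∑ (λ i → δ k i * F i)  ≡⟨ cong (_+ ∑ (λ i → δ k i * F i)) (*-zeroˡ (f zero)) ⟩
  0ℚ + ∑ (λ i → δ k i * F i)           ≡⟨ +-identityˡ (∑ (λ i → δ k i * F i)) ⟩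
  ∑ (λ i → δ k i * F i)                ≡⟨ ∑-δ k F ⟩
  F k                                  ∎
  where
  open ≡-Reasoning
  F = λ i → f (suc i)

transfer : Fin n → Fin n → (Fin n → ℚ) → Fin n → ℚ
transfer t s x i = x i + x t * (δ s i - δ t i)

∑-transfer-* : (t s : Fin n) (x f : Fin n → ℚ) →
  ∑ (λ i → transfer t s x i * f i) ≡ ∑ (λ i → x i * f i) + x t * (f s - f t)
∑-transfer-* t s x f = begin
  ∑ (λ i → transfer t s x i * f i)
    ≡⟨ ∑-cong (λ i → solve 5 (λ xi xt ds dt fi → (xi :+ xt :* (ds :- dt)) :* fi
                                                 := xi :* fi :+ xt :* (ds :* fi :- dt :* fi))
                             refl (x i) (x t) (δ s i) (δ t i) (f i)) ⟩
  ∑ (λ i → x i * f i + x t * (δ s i * f i - δ t i * f i))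
    ≡⟨ ∑-distrib-+ (λ i → x i * f i) (λ i → x t * (δ s i * f i - δ t i * f i)) ⟩
  ∑ (λ i → x i * f i) + ∑ (λ i → x t * (δ s i * f i - δ t i * f i))
    ≡⟨ cong (∑ (λ i → x i * f i) +_) (sym (*-distribˡ-∑ (x t) (λ i → δ s i * f i - δ t i * f i))) ⟩
  ∑ (λ i → x i * f i) + x t * ∑ (λ i → δ s i * f i - δ t i * f i)
    ≡⟨ cong (λ d → ∑ (λ i → x i * f i) + x t * d) (∑-distrib-- (λ i → δ s i * f i) (λ i → δ t i * f i)) ⟩
  ∑ (λ i → x i * f i) + x t * (∑ (λ i → δ s i * f i) - ∑ (λ i → δ t i * f i))
    ≡⟨ cong (λ d → ∑ (λ i → x i * f i) + x t * d) (cong₂ _-_ (∑-δ s f) (∑-δ t f)) ⟩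
  ∑ (λ i → x i * f i) + x t * (f s - f t)
    ∎
  where open ≡-Reasoning

transfer-isProfile : {t s : Fin n} {x : Fin n → ℚ} →
                     s ≢ t → IsProfile x → IsProfile (transfer t s x)
transfer-isProfile {t = t} {s} {x} s≢t (x≥0 , ∑x≡1) = transfer≥0 , ∑transfer≡1
  where
  transfer≥0 : ∀ i → 0ℚ ≤ transfer t s x i
  transfer≥0 i with i ≟ s | i ≟ t
  ... | yes refl | _ rewrite δ-diag s | δ-offDiag (s≢t ∘ sym) | *-identityʳ (x t) =
    +-mono-≤ (x≥0 s) (x≥0 t)
  ... | no _ | yes refl rewrite δ-diag t | δ-offDiag s≢t =
    ≤-reflexive (solve 1 (λ y → con 0ℚ := y :+ y :* (con 0ℚ :- con 1ℚ)) refl (x t))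
  ... | no i≢s | no i≢t rewrite δ-offDiag (i≢s ∘ sym) | δ-offDiag (i≢t ∘ sym)
                              | *-zeroʳ (x t) | +-identityʳ (x i) =
    x≥0 i
  ∑transfer≡1 : ∑ (transfer t s x) ≡ 1ℚ
  ∑transfer≡1 = begin
    ∑ (transfer t s x)                         ≡⟨ ∑-cong (λ i → sym (*-identityʳ (transfer t s x i))) ⟩
    ∑ (λ i → transfer t s x i * 1ℚ)            ≡⟨ ∑-transfer-* t s x (λ _ → 1ℚ) ⟩
    ∑ (λ i → x i * 1ℚ) + x t * (1ℚ - 1ℚ)       ≡⟨ cong₂ _+_ (∑-cong (λ i → *-identityʳ (x i)))
                                                            (*-zeroʳ (x t)) ⟩
    ∑ x + 0ℚ                                   ≡⟨ +-identityʳ (∑ x) ⟩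
    ∑ x                                        ≡⟨ ∑x≡1 ⟩
    1ℚ                                         ∎
    where open ≡-Reasoning

g-diag : (T : Tournament n) (i : Fin n) → g T i i ≡ 1ℚ
g-diag T i with i ≟ i
... | yes _   = refl
... | no  i≢i = ⊥-elim (i≢i refl)

g-offDiag : (T : Tournament n) {i j : Fin n} →
            i ≢ j → g T i j ≡ (if beats T i j then ℤ.+ 2 / 1 else 0ℚ)
g-offDiag T {i} {j} i≢j with i ≟ j
... | yes i≡j = ⊥-elim (i≢j i≡j)
... | no  _   = refl

g-skew : (T : Tournament n) (i j : Fin n) → g T i j + g T j i ≡ ℤ.+ 2 / 1
g-skew T i j with i ≟ j
... | yes refl = cong (1ℚ +_) (g-diag T i)
... | no  i≢j rewrite g-offDiag T (i≢j ∘ sym) | exactlyOne T i j i≢j with beats T i j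
...   | true  = refl
...   | false = refl

payoff : Tournament n → (Fin n → ℚ) → (Fin n → ℚ) → ℚ
payoff T x y = ∑ λ i → ∑ λ j → g T i j * x i * y j

row : Tournament n → (Fin n → ℚ) → Fin n → ℚ
row T y i = ∑ λ j → g T i j * y j

payoff≡∑-row : (T : Tournament n) (x y : Fin n → ℚ) → payoff T x y ≡ ∑ (λ i → x i * row T y i)
payoff≡∑-row T x y = ∑-cong λ i → begin
  ∑ (λ j → g T i j * x i * y j)    ≡⟨ ∑-cong (λ j → solve 3 (λ G X Y → G :* X :* Y := X :* (G :* Y))
                                                        refl (g T i j) (x i) (y j)) ⟩
  ∑ (λ j → x i * (g T i j * y j))  ≡⟨ sym (*-distribˡ-∑ (x i) (λ j → g T i j * y j)) ⟩
  x i * row T y i                  ∎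
  where open ≡-Reasoning

payoff-transfer : (T : Tournament n) (t s : Fin n) (x y : Fin n → ℚ) →
  payoff T (transfer t s x) y ≡ payoff T x y + x t * (row T y s - row T y t)
payoff-transfer T t s x y = begin
  payoff T (transfer t s x) y               ≡⟨ payoff≡∑-row T (transfer t s x) y ⟩
  ∑ (λ i → transfer t s x i * row T y i)    ≡⟨ ∑-transfer-* t s x (row T y) ⟩
  ∑ (λ i → x i * row T y i) + x t * D       ≡⟨ cong (_+ x t * D) (sym (payoff≡∑-row T x y)) ⟩
  payoff T x y + x t * D                    ∎
  where
  open ≡-Reasoning
  D = row T y s - row T y t

payoff-constantSum : (T : Tournament n) (x y : Fin n → ℚ) →
  payoff T x y + payoff T y x ≡ ℤ.+ 2 / 1 * (∑ x * ∑ y)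
payoff-constantSum T x y = begin
  payoff T x y + payoff T y x
    ≡⟨ cong (payoff T x y +_) (∑-comm (λ i j → g T i j * y i * x j)) ⟩
  ∑ (λ i → ∑ (A i)) + ∑ (λ i → ∑ (B i))
    ≡⟨ sym (∑-distrib-+ (λ i → ∑ (A i)) (λ i → ∑ (B i))) ⟩
  ∑ (λ i → ∑ (A i) + ∑ (B i))
    ≡⟨ ∑-cong (λ i → sym (∑-distrib-+ (A i) (B i))) ⟩
  ∑ (λ i → ∑ (λ j → A i j + B i j))
    ≡⟨ ∑-cong (λ i → ∑-cong (λ j → A+B≡2xy i j)) ⟩
  ∑ (λ i → ∑ (λ j → two * (x i * y j)))
    ≡⟨ ∑-cong (λ i → sym (*-distribˡ-∑ two (λ j → x i * y j))) ⟩
  ∑ (λ i → two * ∑ (λ j → x i * y j))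
    ≡⟨ sym (*-distribˡ-∑ two (λ i → ∑ (λ j → x i * y j))) ⟩
  two * ∑ (λ i → ∑ (λ j → x i * y j))
    ≡⟨ cong (two *_) (sym (∑*∑ x y)) ⟩
  two * (∑ x * ∑ y)
    ∎
  where
  open ≡-Reasoning
  two = ℤ.+ 2 / 1
  A B : Fin _ → Fin _ → ℚ
  A i j = g T i j * x i * y j
  B i j = g T j i * y j * x i
  A+B≡2xy : ∀ i j → A i j + B i j ≡ two * (x i * y j)
  A+B≡2xy i j = trans
    (solve 4 (λ G H X Y → G :* X :* Y :+ H :* Y :* X := (G :+ H) :* (X :* Y))
             refl (g T i j) (g T j i) (x i) (y j))
    (cong (_* (x i * y j)) (g-skew T i j))

+-cancelˡ-≤ : ∀ r {p q} → r + p ≤ r + q → p ≤ q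
+-cancelˡ-≤ r {p} {q} r+p≤r+q = begin
  p              ≡⟨ solve 2 (λ r p → p := (r :+ p) :- r) refl r p ⟩
  (r + p) - r    ≤⟨ +-monoˡ-≤ (- r) r+p≤r+q ⟩
  (r + q) - r    ≡⟨ solve 2 (λ r q → (r :+ q) :- r := q) refl r q ⟩
  q              ∎
  where open ≤-Reasoning

nash⇒payoff-against≤1 : (T : Tournament n) {a b : Fin n → ℚ} →
  IsNashEquilibrium T a → IsProfile b → payoff T b a ≤ 1ℚ
nash⇒payoff-against≤1 T {a} {b} ((_ , ∑a≡1) , nash) b-isProfile@(_ , ∑b≡1) =
  +-cancelˡ-≤ (payoff T a b) (begin
    payoff T a b + payoff T b a          ≡⟨ payoff-constantSum T a b ⟩
    ℤ.+ 2 / 1 * (∑ a * ∑ b)              ≡⟨ cong₂ (λ u v → ℤ.+ 2 / 1 * (u * v)) ∑a≡1 ∑b≡1 ⟩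
    1ℚ + 1ℚ                              ≤⟨ +-monoˡ-≤ 1ℚ (nash b b-isProfile) ⟩
    payoff T a b + 1ℚ                    ∎)
  where open ≤-Reasoning

dominates⇒≢ : (T : Tournament n) {s t : Fin n} → Dominates T s t → s ≢ t
dominates⇒≢ T {s} (s▷s , _) refl with trans (sym (irrefl T s)) s▷s
... | ()

dominates⇒g-gap : (T : Tournament n) {s t : Fin n} →
                  Dominates T s t → ∀ j → δ t j ≤ g T s j - g T t j
dominates⇒g-gap T {s} {t} dom@(s▷t , noCycle) j with j ≟ t | j ≟ s
... | yes refl | _ rewrite δ-diag t | g-diag T t | g-offDiag T (dominates⇒≢ T dom) | s▷t =
  ≤ᵇ⇒≤ _
... | no j≢t | yes refl rewrite δ-offDiag (j≢t ∘ sym) | g-diag T s | g-offDiag T (j≢t ∘ sym)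
                              | exactlyOne T s t j≢t | s▷t =
  ≤ᵇ⇒≤ _
... | no j≢t | no j≢s rewrite δ-offDiag (j≢t ∘ sym) | g-offDiag T (j≢s ∘ sym)
                            | g-offDiag T (j≢t ∘ sym) | exactlyOne T j s j≢s
  with beats T t j in t▷j | beats T j s in j▷s
...   | true  | true  = ⊥-elim (noCycle (j , j≢s , j≢t , t▷j , j▷s))
...   | true  | false = ≤ᵇ⇒≤ _
...   | false | true  = ≤ᵇ⇒≤ _
...   | false | false = ≤ᵇ⇒≤ _

dominates⇒row-gap : (T : Tournament n) {s t : Fin n} {y : Fin n → ℚ} → Dominates T s t →
  (∀ j → 0ℚ ≤ y j) → y t ≤ row T y s - row T y t
dominates⇒row-gap T {s} {t} {y} dom y≥0 = begin
  y t
    ≡⟨ sym (∑-δ t y) ⟩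
  ∑ (λ j → δ t j * y j)
    ≤⟨ ∑-mono-≤ (λ j → *-monoʳ-≤-nonNeg (y j) {{nonNegative (y≥0 j)}} (dominates⇒g-gap T dom j)) ⟩
  ∑ (λ j → (g T s j - g T t j) * y j)
    ≡⟨ ∑-cong (λ j → solve 3 (λ G H Y → (G :- H) :* Y := G :* Y :- H :* Y) refl (g T s j) (g T t j) (y j)) ⟩
  ∑ (λ j → g T s j * y j - g T t j * y j)
    ≡⟨ ∑-distrib-- (λ j → g T s j * y j) (λ j → g T t j * y j) ⟩
  row T y s - row T y t
    ∎
  where open ≤-Reasoning

0≤p⇒p*p≤0⇒p≡0 : {p : ℚ} → 0ℚ ≤ p → p * p ≤ 0ℚ → p ≡ 0ℚ
0≤p⇒p*p≤0⇒p≡0 {p} 0≤p p*p≤0 = ≤-antisym (≮⇒≥ 0≮p) 0≤p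
  where
  0≮p : ¬ 0ℚ < p
  0≮p 0<p = <-irrefl refl (<-≤-trans (positive⁻¹ (p * p) {{pos*pos⇒pos p p}}) p*p≤0)
    where instance _ = positive 0<p

theorem3p3 : (n : ℕ) (T : Tournament n) (a : Fin n → ℚ) →
    IsNashEquilibrium T a →
    (s t : Fin n) → Dominates T s t → a t ≡ 0ℚ
theorem3p3 n T a isNash@(a-isProfile@(a≥0 , _) , nash) s t dom =
  0≤p⇒p*p≤0⇒p≡0 (a≥0 t) (begin
    a t * a t    ≤⟨ *-monoˡ-≤-nonNeg (a t) {{nonNegative (a≥0 t)}} (dominates⇒row-gap T dom a≥0) ⟩
    a t * D      ≤⟨ +-cancelˡ-≤ (payoff T a a) transfer-gain ⟩
    0ℚ           ∎)
  where
  open ≤-Reasoning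
  D = row T a s - row T a t
  a' = transfer t s a
  transfer-gain : payoff T a a + a t * D ≤ payoff T a a + 0ℚ
  transfer-gain = begin
    payoff T a a + a t * D    ≡⟨ sym (payoff-transfer T t s a a) ⟩
    payoff T a' a             ≤⟨ nash⇒payoff-against≤1 T isNash
                                   (transfer-isProfile (dominates⇒≢ T dom) a-isProfile) ⟩
    1ℚ                        ≤⟨ nash a a-isProfile ⟩
    payoff T a a              ≡⟨ sym (+-identityʳ (payoff T a a)) ⟩
    payoff T a a + 0ℚ         ∎
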